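{- For all positive integers $t_1,t_2,t_3$, the rank of the Hermitian adjacency matrix of $\overrightarrow{C_3}(t_1,t_2,t_3)$ equals $2$.
   Context: For positive integers $t_1,t_2,t_3$, $\overrightarrow{C_3}(t_1,t_2,t_3)$ is the mixed complete tripartite graph with parts $A,B,C$, $|A|=t_1,|B|=t_2,|C|=t_3$, in which every edge between $A$ and $B$ is an arc from $A$ to $B$, between $B$ and $C$ an arc from $B$ to $C$, and between $C$ and $A$ an arc from $C$ to $A$. The Hermitian adjacency matrix $H=(h_{st})$ of a mixed graph has $h_{st}=1$ for an undirected edge $v_sv_t$, $h_{st}=i$ for an arc from $v_s$ to $v_t$, $h_{st}=-i$ for an arc from $v_t$ to $v_s$, and $0$ otherwise. -}

module Defs where

open import Data.Nat using (ℕ; zero; suc)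
import Data.Integer as ℤ
open import Data.Integer using (ℤ; +_)
open import Data.Fin using (Fin; splitAt)
open import Data.Sum using (_⊎_; inj₁; inj₂)
open import Data.Product using (Σ; _×_)
open import Relation.Binary.PropositionalEquality using (_≡_)
open import Relation.Nullary using (¬_)

-- Gaussian integers ℤ[i] ⊂ ℂ  (all Hermitian adjacency entries lie here)

record ℤ[i] : Set where
  constructor _+_i
  field
    re : ℤ
    im : ℤ
open ℤ[i] public

0ᵍ 1ᵍ iᵍ -iᵍ : ℤ[i]
0ᵍ  = (+ 0) + (+ 0) i
1ᵍ  = (+ 1) + (+ 0) i
iᵍ  = (+ 0) + (+ 1) i
-iᵍ = (+ 0) + (ℤ.- (+ 1)) i

_+ᵍ_ : ℤ[i] → ℤ[i] → ℤ[i]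
(a + b i) +ᵍ (c + d i) = (a ℤ.+ c) + (b ℤ.+ d) i

_*ᵍ_ : ℤ[i] → ℤ[i] → ℤ[i]
(a + b i) *ᵍ (c + d i) = ((a ℤ.* c) ℤ.- (b ℤ.* d)) + ((a ℤ.* d) ℤ.+ (b ℤ.* c)) i

Σᵍ : ∀ {r} → (Fin r → ℤ[i]) → ℤ[i]
Σᵍ {zero}  f = 0ᵍ
Σᵍ {suc r} f = f Data.Fin.zero +ᵍ Σᵍ (λ k → f (Data.Fin.suc k))

data EdgeKind : Set where
  noEdge     : EdgeKind
  undirected : EdgeKind
  arcOut     : EdgeKind   -- arc from v_s to v_t
  arcIn      : EdgeKind   -- arc from v_t to v_s

-- kind s t describes the edge (if any) between v_s and v_t, seen from v_s
record MixedGraph (n : ℕ) : Set where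
  field
    kind : Fin n → Fin n → EdgeKind
open MixedGraph public

hermEntry : EdgeKind → ℤ[i]
hermEntry noEdge     = 0ᵍ
hermEntry undirected = 1ᵍ
hermEntry arcOut     = iᵍ
hermEntry arcIn      = -iᵍ

Matrix : ℕ → Set
Matrix n = Fin n → Fin n → ℤ[i]

hermitianAdj : ∀ {n} → MixedGraph n → Matrix n
hermitianAdj G s t = hermEntry (kind G s t)

data Part : Set where
  A B C : Part

part : ∀ t₁ t₂ t₃ → Fin (t₁ Data.Nat.+ t₂ Data.Nat.+ t₃) → Part
part t₁ t₂ t₃ v with splitAt (t₁ Data.Nat.+ t₂) v
... | inj₂ _ = C
... | inj₁ w with splitAt t₁ w
...   | inj₁ _ = A
...   | inj₂ _ = B

partKind : Part → Part → EdgeKind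
partKind A B = arcOut
partKind B A = arcIn
partKind B C = arcOut
partKind C B = arcIn
partKind C A = arcOut
partKind A C = arcIn
partKind A A = noEdge
partKind B B = noEdge
partKind C C = noEdge

C₃ : ∀ t₁ t₂ t₃ → MixedGraph (t₁ Data.Nat.+ t₂ Data.Nat.+ t₃)
C₃ t₁ t₂ t₃ = record { kind = λ s t → partKind (part t₁ t₂ t₃ s) (part t₁ t₂ t₃ t) }

-- Linear independence is taken over ℤ[i]; since all entries lie in ℤ[i],
-- this coincides with linear independence over ℚ(i) and over ℂ.

LinIndep : ∀ {r n} → (Fin r → Fin n → ℤ[i]) → Set
LinIndep {r} {n} v =
  (c : Fin r → ℤ[i]) → (∀ j → Σᵍ (λ k → c k *ᵍ v k j) ≡ 0ᵍ) → ∀ k → c k ≡ 0ᵍ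

HasRank : ∀ {n} → Matrix n → ℕ → Set
HasRank {n} M r =
  Σ (Fin r → Fin n) (λ rows → LinIndep (λ k → M (rows k)))
  × ((rows : Fin (suc r) → Fin n) → ¬ LinIndep (λ k → M (rows k)))

-- The entry of H at (v, w) depends only on the parts of v and w: H v w = M (part v) (part w), where
-- M is the 3 × 3 matrix with zero diagonal, i on the cyclic arcs A→B→C→A and −i on the reverse ones.
-- Rows from two different parts are independent, because M restricted to those two rows and columns
-- is antidiagonal with entries ±i, which are not zero divisors. Among any three rows either two come
-- from the same part, and are equal, or all three parts occur, and the rows sum to zero since every
-- column of M consists of 0, i and −i.
module Submission where

open import Defs
open import Data.Nat using (ℕ; suc; _≤_)
import Data.Nat as ℕ
import Data.Integer as ℤ
open import Data.Integer using (+_)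
open import Data.Integer.Properties using (+-identityˡ; +-identityʳ; *-zeroʳ; neg-injective)
open import Data.Integer.Tactic.RingSolver using (solve-∀)
open import Data.Fin using (Fin; zero; suc; _↑ˡ_; _↑ʳ_)
open import Data.Fin.Properties using (splitAt-↑ˡ; splitAt-↑ʳ)
open import Data.Vec.Functional using ([]; _∷_)
open import Data.Product using (Σ-syntax; ∃-syntax; _×_; _,_; proj₁; proj₂)
open import Function using (_∘_)
open import Relation.Binary.PropositionalEquality
open import Relation.Nullary using (¬_; contradiction)

-1ᵍ : ℤ[i]
-1ᵍ = (ℤ.- + 1) + (+ 0) i

+ᵍ-identityˡ : ∀ x → 0ᵍ +ᵍ x ≡ x
+ᵍ-identityˡ (a + b i) = cong₂ _+_i (+-identityˡ a) (+-identityˡ b)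

+ᵍ-identityʳ : ∀ x → x +ᵍ 0ᵍ ≡ x
+ᵍ-identityʳ (a + b i) = cong₂ _+_i (+-identityʳ a) (+-identityʳ b)

*ᵍ-zeroʳ : ∀ x → x *ᵍ 0ᵍ ≡ 0ᵍ
*ᵍ-zeroʳ (a + b i) = cong₂ _+_i (cong₂ ℤ._-_ (*-zeroʳ a) (*-zeroʳ b)) (cong₂ ℤ._+_ (*-zeroʳ a) (*-zeroʳ b))

1x-1x≡0 : ∀ x → (1ᵍ *ᵍ x) +ᵍ ((-1ᵍ *ᵍ x) +ᵍ 0ᵍ) ≡ 0ᵍ
1x-1x≡0 (a + b i) = cong₂ _+_i (re≡0 a b) (im≡0 a b)
  where
  re≡0 : ∀ a b → (+ 1 ℤ.* a ℤ.- + 0 ℤ.* b) ℤ.+ ((ℤ.- + 1 ℤ.* a ℤ.- + 0 ℤ.* b) ℤ.+ + 0) ≡ + 0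
  re≡0 = solve-∀
  im≡0 : ∀ a b → (+ 1 ℤ.* b ℤ.+ + 0 ℤ.* a) ℤ.+ ((ℤ.- + 1 ℤ.* b ℤ.+ + 0 ℤ.* a) ℤ.+ + 0) ≡ + 0
  im≡0 = solve-∀

*ᵍ-iᵍ : ∀ x → x *ᵍ iᵍ ≡ (ℤ.- im x) + re x i
*ᵍ-iᵍ (a + b i) = cong₂ _+_i (re≡ a b) (im≡ a b)
  where
  re≡ : ∀ a b → a ℤ.* + 0 ℤ.- b ℤ.* + 1 ≡ ℤ.- b
  re≡ = solve-∀
  im≡ : ∀ a b → a ℤ.* + 1 ℤ.+ b ℤ.* + 0 ≡ a
  im≡ = solve-∀

*ᵍ--iᵍ : ∀ x → x *ᵍ -iᵍ ≡ im x + (ℤ.- re x) i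
*ᵍ--iᵍ (a + b i) = cong₂ _+_i (re≡ a b) (im≡ a b)
  where
  re≡ : ∀ a b → a ℤ.* + 0 ℤ.- b ℤ.* ℤ.- + 1 ≡ b
  re≡ = solve-∀
  im≡ : ∀ a b → a ℤ.* ℤ.- + 1 ℤ.+ b ℤ.* + 0 ≡ ℤ.- a
  im≡ = solve-∀

NonZeroDivisor : ℤ[i] → Set
NonZeroDivisor u = ∀ x → x *ᵍ u ≡ 0ᵍ → x ≡ 0ᵍ

iᵍ-nonZeroDivisor : NonZeroDivisor iᵍ
iᵍ-nonZeroDivisor (a + b i) xi≡0 = cong₂ _+_i (cong im -b+ai≡0) (neg-injective (cong re -b+ai≡0))
  where
  -b+ai≡0 : (ℤ.- b) + a i ≡ 0ᵍ
  -b+ai≡0 = trans (sym (*ᵍ-iᵍ (a + b i))) xi≡0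

-iᵍ-nonZeroDivisor : NonZeroDivisor -iᵍ
-iᵍ-nonZeroDivisor (a + b i) x-i≡0 = cong₂ _+_i (neg-injective (cong im b-ai≡0)) (cong re b-ai≡0)
  where
  b-ai≡0 : b + (ℤ.- a) i ≡ 0ᵍ
  b-ai≡0 = trans (sym (*ᵍ--iᵍ (a + b i))) x-i≡0

Annihilates : ∀ {r} {X : Set} → (Fin r → ℤ[i]) → (Fin r → X → ℤ[i]) → Set
Annihilates c v = ∀ x → Σᵍ (λ k → c k *ᵍ v k x) ≡ 0ᵍ

Independent : ∀ {r} {X : Set} → (Fin r → X → ℤ[i]) → Set
Independent {r} v = (c : Fin r → ℤ[i]) → Annihilates c v → ∀ k → c k ≡ 0ᵍ

Dependent : ∀ {r} {X : Set} → (Fin r → X → ℤ[i]) → Set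
Dependent {r} v = Σ[ c ∈ (Fin r → ℤ[i]) ] Annihilates c v × ∃[ k ] ¬ c k ≡ 0ᵍ

dependent⇒¬independent : ∀ {r} {X : Set} {v : Fin r → X → ℤ[i]} → Dependent v → ¬ Independent v
dependent⇒¬independent (c , c-annihilates , k , ck≢0) independent = ck≢0 (independent c c-annihilates k)

independent-∘ : ∀ {r} {X Y : Set} {v : Fin r → X → ℤ[i]} (g : Y → X) → (∀ x → ∃[ y ] g y ≡ x) →
                Independent v → Independent (λ k → v k ∘ g)
independent-∘ {v = v} g g-surjective independent c c-annihilates = independent c annihilates
  where
  annihilates : Annihilates c v
  annihilates x with g-surjective x
  ... | y , refl = c-annihilates y

dependent-∘ : ∀ {r} {X Y : Set} {v : Fin r → X → ℤ[i]} (g : Y → X) → Dependent v → Dependent (λ k → v k ∘ g)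
dependent-∘ g (c , c-annihilates , nonzero) = c , c-annihilates ∘ g , nonzero

antidiagonal⇒independent : ∀ {X : Set} {v₀ v₁ : X → ℤ[i]} {s t : X} →
                           v₀ s ≡ 0ᵍ → v₁ t ≡ 0ᵍ → NonZeroDivisor (v₀ t) → NonZeroDivisor (v₁ s) →
                           Independent (v₀ ∷ v₁ ∷ [])
antidiagonal⇒independent {X} {v₀} {v₁} {s} {t} v₀s≡0 v₁t≡0 v₀t-nzd v₁s-nzd c c-annihilates = λ
  { zero       → v₀t-nzd c₀ (begin
      c₀ *ᵍ v₀ t                             ≡⟨ sym (+ᵍ-identityʳ _) ⟩
      (c₀ *ᵍ v₀ t) +ᵍ 0ᵍ                     ≡⟨ cong (λ z → (c₀ *ᵍ v₀ t) +ᵍ (z +ᵍ 0ᵍ)) (sym (times0 c₁ v₁t≡0)) ⟩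
      (c₀ *ᵍ v₀ t) +ᵍ ((c₁ *ᵍ v₁ t) +ᵍ 0ᵍ)   ≡⟨ c-annihilates t ⟩
      0ᵍ                                     ∎)
  ; (suc zero) → v₁s-nzd c₁ (begin
      c₁ *ᵍ v₁ s                             ≡⟨ sym (trans (+ᵍ-identityˡ _) (+ᵍ-identityʳ _)) ⟩
      0ᵍ +ᵍ ((c₁ *ᵍ v₁ s) +ᵍ 0ᵍ)             ≡⟨ cong (_+ᵍ ((c₁ *ᵍ v₁ s) +ᵍ 0ᵍ)) (sym (times0 c₀ v₀s≡0)) ⟩
      (c₀ *ᵍ v₀ s) +ᵍ ((c₁ *ᵍ v₁ s) +ᵍ 0ᵍ)   ≡⟨ c-annihilates s ⟩
      0ᵍ                                     ∎)
  }
  where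
  open ≡-Reasoning
  c₀ c₁ : ℤ[i]
  c₀ = c zero
  c₁ = c (suc zero)
  times0 : ∀ x {y} → y ≡ 0ᵍ → x *ᵍ y ≡ 0ᵍ
  times0 x refl = *ᵍ-zeroʳ x

-- Here 0ᵍ *ᵍ y reduces to 0ᵍ for every y, since ℤ multiplication computes on a left factor +0;
-- so the vanishing coefficient drops out of each combination definitionally.
row₀≡row₁⇒dependent : ∀ {X : Set} {u w : X → ℤ[i]} → Dependent (u ∷ u ∷ w ∷ [])
row₀≡row₁⇒dependent {u = u} = (1ᵍ ∷ -1ᵍ ∷ 0ᵍ ∷ []) , (λ x → 1x-1x≡0 (u x)) , zero , λ ()

row₀≡row₂⇒dependent : ∀ {X : Set} {u w : X → ℤ[i]} → Dependent (u ∷ w ∷ u ∷ [])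
row₀≡row₂⇒dependent {u = u} = (1ᵍ ∷ 0ᵍ ∷ -1ᵍ ∷ []) , annihilates , zero , λ ()
  where
  annihilates : ∀ x → (1ᵍ *ᵍ u x) +ᵍ (0ᵍ +ᵍ ((-1ᵍ *ᵍ u x) +ᵍ 0ᵍ)) ≡ 0ᵍ
  annihilates x = trans (cong ((1ᵍ *ᵍ u x) +ᵍ_) (+ᵍ-identityˡ _)) (1x-1x≡0 (u x))

row₁≡row₂⇒dependent : ∀ {X : Set} {u w : X → ℤ[i]} → Dependent (w ∷ u ∷ u ∷ [])
row₁≡row₂⇒dependent {u = u} = (0ᵍ ∷ 1ᵍ ∷ -1ᵍ ∷ []) , (λ x → trans (+ᵍ-identityˡ _) (1x-1x≡0 (u x))) , suc zero , λ ()

rowSum≡0⇒dependent : ∀ {X : Set} {u v w : X → ℤ[i]} → Annihilates (λ _ → 1ᵍ) (u ∷ v ∷ w ∷ []) →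
                     Dependent (u ∷ v ∷ w ∷ [])
rowSum≡0⇒dependent ones-annihilate = (λ _ → 1ᵍ) , ones-annihilate , zero , λ ()

partMatrix : Part → Part → ℤ[i]
partMatrix p q = hermEntry (partKind p q)

partMatrix-diagonal : ∀ p → partMatrix p p ≡ 0ᵍ
partMatrix-diagonal A = refl
partMatrix-diagonal B = refl
partMatrix-diagonal C = refl

partMatrix-nonZeroDivisor : ∀ {p q} → ¬ p ≡ q → NonZeroDivisor (partMatrix p q)
partMatrix-nonZeroDivisor {A} {B} _ = iᵍ-nonZeroDivisor
partMatrix-nonZeroDivisor {B} {C} _ = iᵍ-nonZeroDivisor
partMatrix-nonZeroDivisor {C} {A} _ = iᵍ-nonZeroDivisor
partMatrix-nonZeroDivisor {B} {A} _ = -iᵍ-nonZeroDivisor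
partMatrix-nonZeroDivisor {C} {B} _ = -iᵍ-nonZeroDivisor
partMatrix-nonZeroDivisor {A} {C} _ = -iᵍ-nonZeroDivisor
partMatrix-nonZeroDivisor {A} {A} A≢A = contradiction refl A≢A
partMatrix-nonZeroDivisor {B} {B} B≢B = contradiction refl B≢B
partMatrix-nonZeroDivisor {C} {C} C≢C = contradiction refl C≢C

partMatrix-twoRows-independent : ∀ {p q} → ¬ p ≡ q → Independent (partMatrix p ∷ partMatrix q ∷ [])
partMatrix-twoRows-independent {p} {q} p≢q =
  antidiagonal⇒independent (partMatrix-diagonal p) (partMatrix-diagonal q)
                           (partMatrix-nonZeroDivisor p≢q) (partMatrix-nonZeroDivisor (p≢q ∘ sym))

partMatrix-threeRows-dependent : ∀ p q r → Dependent (partMatrix p ∷ partMatrix q ∷ partMatrix r ∷ [])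
partMatrix-threeRows-dependent A A _ = row₀≡row₁⇒dependent
partMatrix-threeRows-dependent B B _ = row₀≡row₁⇒dependent
partMatrix-threeRows-dependent C C _ = row₀≡row₁⇒dependent
partMatrix-threeRows-dependent A _ A = row₀≡row₂⇒dependent
partMatrix-threeRows-dependent B _ B = row₀≡row₂⇒dependent
partMatrix-threeRows-dependent C _ C = row₀≡row₂⇒dependent
partMatrix-threeRows-dependent _ A A = row₁≡row₂⇒dependent
partMatrix-threeRows-dependent _ B B = row₁≡row₂⇒dependent
partMatrix-threeRows-dependent _ C C = row₁≡row₂⇒dependent
partMatrix-threeRows-dependent A B C = rowSum≡0⇒dependent (λ { A → refl ; B → refl ; C → refl })
partMatrix-threeRows-dependent A C B = rowSum≡0⇒dependent (λ { A → refl ; B → refl ; C → refl })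
partMatrix-threeRows-dependent B A C = rowSum≡0⇒dependent (λ { A → refl ; B → refl ; C → refl })
partMatrix-threeRows-dependent B C A = rowSum≡0⇒dependent (λ { A → refl ; B → refl ; C → refl })
partMatrix-threeRows-dependent C A B = rowSum≡0⇒dependent (λ { A → refl ; B → refl ; C → refl })
partMatrix-threeRows-dependent C B A = rowSum≡0⇒dependent (λ { A → refl ; B → refl ; C → refl })

part-surjective : ∀ {t₁ t₂ t₃} → 1 ≤ t₁ → 1 ≤ t₂ → 1 ≤ t₃ → ∀ p → ∃[ v ] part t₁ t₂ t₃ v ≡ p
part-surjective {suc _} {t₂} {t₃} _ _ _ A = (zero ↑ˡ t₂) ↑ˡ t₃ , refl
part-surjective {t₁} {suc n₂} {t₃} _ _ _ B = (t₁ ↑ʳ zero) ↑ˡ t₃ , B-part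
  where
  B-part : part t₁ (suc n₂) t₃ ((t₁ ↑ʳ zero) ↑ˡ t₃) ≡ B
  B-part rewrite splitAt-↑ˡ (t₁ ℕ.+ suc n₂) (t₁ ↑ʳ zero) t₃ | splitAt-↑ʳ t₁ (suc n₂) zero = refl
part-surjective {t₁} {t₂} {suc n₃} _ _ _ C = (t₁ ℕ.+ t₂) ↑ʳ zero , C-part
  where
  C-part : part t₁ t₂ (suc n₃) ((t₁ ℕ.+ t₂) ↑ʳ zero) ≡ C
  C-part rewrite splitAt-↑ʳ (t₁ ℕ.+ t₂) (suc n₃) zero = refl

lemma3p3 : (t₁ t₂ t₃ : ℕ) → 1 ≤ t₁ → 1 ≤ t₂ → 1 ≤ t₃ →
    HasRank (hermitianAdj (C₃ t₁ t₂ t₃)) 2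
lemma3p3 t₁ t₂ t₃ 1≤t₁ 1≤t₂ 1≤t₃ = (rows , rows-independent) , threeRows-dependent
  where
  H : Matrix (t₁ ℕ.+ t₂ ℕ.+ t₃)
  H = hermitianAdj (C₃ t₁ t₂ t₃)
  partOf : Fin (t₁ ℕ.+ t₂ ℕ.+ t₃) → Part
  partOf = part t₁ t₂ t₃
  vertexIn : ∀ p → ∃[ v ] partOf v ≡ p
  vertexIn = part-surjective 1≤t₁ 1≤t₂ 1≤t₃
  a b : Fin (t₁ ℕ.+ t₂ ℕ.+ t₃)
  a = proj₁ (vertexIn A)
  b = proj₁ (vertexIn B)
  rows : Fin 2 → Fin (t₁ ℕ.+ t₂ ℕ.+ t₃)
  rows = a ∷ b ∷ []
  parts-differ : ¬ partOf a ≡ partOf b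
  parts-differ rewrite proj₂ (vertexIn A) | proj₂ (vertexIn B) = λ ()
  -- Dependent and Independent are not injective in the row family, so it is supplied by hand; it agrees
  -- with the rows of H definitionally once Σᵍ over Fin 2 or Fin 3 unfolds.
  rows-independent : LinIndep (λ k → H (rows k))
  rows-independent = independent-∘ {v = partMatrix (partOf a) ∷ partMatrix (partOf b) ∷ []} partOf vertexIn
                                   (partMatrix-twoRows-independent parts-differ)
  threeRows-dependent : (rs : Fin 3 → Fin (t₁ ℕ.+ t₂ ℕ.+ t₃)) → ¬ LinIndep (λ k → H (rs k))
  threeRows-dependent rs = dependent⇒¬independent {v = λ k → H (rs k)} (dependent-∘ {v = rowParts} partOf
    (partMatrix-threeRows-dependent (partOf (rs zero)) (partOf (rs (suc zero))) (partOf (rs (suc (suc zero))))))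
    where
    rowParts : Fin 3 → Part → ℤ[i]
    rowParts k = partMatrix (partOf (rs k))
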